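{- Let $P$ be a prime and $b,c\in\mathbb{N}$. Suppose $4bc-b-c=P\delta$ with $\delta\in\mathbb{N}$. Let $\alpha$ be a squarefree positive integer and $d'\in\mathbb{N}$ such that $g:=\gcd(b,c)=\alpha d'$. Write $b=gb'$ and $c=gc'$, so that $\gcd(b',c')=1$. Then the following are equivalent: \begin{itemize} \item[(i)] $\delta=\alpha d'^2$; \item[(ii)] $Pd'=4\alpha d'b'c'-(b'+c')$. \end{itemize} When they hold, \[ (4\alpha d'b'-1)(4\alpha d'c'-1)=4\alpha Pd'^2+1, \] and in particular $d'\mid(b'+c')$. -}

module Defs where

open import Data.Nat using (ℕ; _*_)
open import Data.Nat.Divisibility using (_∣_)
open import Data.Nat.Primality using (Prime)
open import Relation.Nullary using (¬_)

SquareFree : ℕ → Set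
SquareFree n = ∀ p → Prime p → ¬ (p * p ∣ n)

{-# OPTIONS --safe #-}
-- Substituting b = g b', c = g c' (g = α d') turns 4bc = Pδ + b + c into
-- g · 4αd'b'c' = Pδ + g(b' + c'), while trivially g (Pd' + b' + c') = P · αd'² + g(b' + c').
-- The two right-hand sides agree exactly when δ = αd'², and the left-hand sides exactly when
-- (ii) holds, so (i) ⇔ (ii) after cancelling g and P.  Multiplying (ii) by 4αd' gives the product
-- identity, and reducing (ii) modulo d' gives d' ∣ b' + c'.
module Submission where

open import Defs
open import Data.Nat using (ℕ; _+_; _*_; _<_; NonZero; >-nonZero)
open import Data.Nat.Properties using (*-assoc; *-cancelˡ-≡; +-cancelʳ-≡; m*n≢0⇒m≢0)
open import Data.Nat.Divisibility using (_∣_; divides; n∣m*n; ∣m+n∣m⇒∣n)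
open import Data.Nat.GCD using (gcd)
open import Data.Nat.Primality using (Prime; prime⇒nonZero)
open import Data.Integer using (+_) renaming (_+_ to _+ℤ_; _*_ to _*ℤ_; _-_ to _-ℤ_)
open import Data.Integer.Properties using (pos-+; pos-*)
open import Data.Product using (_×_; _,_)
open import Function.Bundles using (_⇔_; mk⇔; Equivalence)
open import Relation.Binary.PropositionalEquality
import Data.Nat.Tactic.RingSolver as ℕ-Ring
import Data.Integer.Tactic.RingSolver as ℤ-Ring

open ≡-Reasoning

affine-cancel-⇔ : ∀ {g P m n s x y} .{{_ : NonZero g}} .{{_ : NonZero P}} →
  g * x ≡ P * m + s → g * y ≡ P * n + s → (m ≡ n ⇔ y ≡ x)
affine-cancel-⇔ {g} {P} {m} {n} {s} {x} {y} gx≡Pm+s gy≡Pn+s = mk⇔ to from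
  where
  to : m ≡ n → y ≡ x
  to refl = *-cancelˡ-≡ y x g (trans gy≡Pn+s (sym gx≡Pm+s))

  from : y ≡ x → m ≡ n
  from refl = *-cancelˡ-≡ m n P (+-cancelʳ-≡ s (P * m) (P * n) (trans (sym gx≡Pm+s) gy≡Pn+s))

substitute-common-factor : ∀ P δ {b c} g b' c' →
  4 * b * c ≡ P * δ + b + c → b ≡ g * b' → c ≡ g * c' →
  g * (4 * g * b' * c') ≡ P * δ + g * (b' + c')
substitute-common-factor P δ g b' c' 4bc≡Pδ+b+c refl refl = begin
  g * (4 * g * b' * c')             ≡⟨ factor-out-g g b' c' ⟩
  4 * (g * b') * (g * c')           ≡⟨ 4bc≡Pδ+b+c ⟩
  P * δ + g * b' + g * c'           ≡⟨ collect-g (P * δ) g b' c' ⟩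
  P * δ + g * (b' + c')             ∎
  where
  factor-out-g : ∀ g b' c' → g * (4 * g * b' * c') ≡ 4 * (g * b') * (g * c')
  factor-out-g = ℕ-Ring.solve-∀

  collect-g : ∀ t g b' c' → t + g * b' + g * c' ≡ t + g * (b' + c')
  collect-g = ℕ-Ring.solve-∀

pred*pred≡suc : ∀ {a c q} → a * c ≡ q + a + c → (+ a -ℤ + 1) *ℤ (+ c -ℤ + 1) ≡ + q +ℤ + 1
pred*pred≡suc {a} {c} {q} ac≡q+a+c = begin
  (+ a -ℤ + 1) *ℤ (+ c -ℤ + 1)                 ≡⟨ expand (+ a) (+ c) ⟩
  + a *ℤ + c -ℤ + a -ℤ + c +ℤ + 1              ≡⟨ cong (λ t → t -ℤ + a -ℤ + c +ℤ + 1) ac≡q+a+c-in-ℤ ⟩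
  (+ q +ℤ + a +ℤ + c) -ℤ + a -ℤ + c +ℤ + 1     ≡⟨ cancel (+ q) (+ a) (+ c) ⟩
  + q +ℤ + 1                                   ∎
  where
  expand : ∀ a c → (a -ℤ + 1) *ℤ (c -ℤ + 1) ≡ a *ℤ c -ℤ a -ℤ c +ℤ + 1
  expand = ℤ-Ring.solve-∀

  cancel : ∀ q a c → (q +ℤ a +ℤ c) -ℤ a -ℤ c +ℤ + 1 ≡ q +ℤ + 1
  cancel = ℤ-Ring.solve-∀

  ac≡q+a+c-in-ℤ : + a *ℤ + c ≡ + q +ℤ + a +ℤ + c
  ac≡q+a+c-in-ℤ = begin
    + a *ℤ + c          ≡⟨ pos-* a c ⟨
    + (a * c)           ≡⟨ cong +_ ac≡q+a+c ⟩
    + (q + a + c)       ≡⟨ pos-+ (q + a) c ⟩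
    + (q + a) +ℤ + c    ≡⟨ cong (_+ℤ + c) (pos-+ q a) ⟩
    + q +ℤ + a +ℤ + c   ∎

module _ (P α d' b' c' : ℕ) (ii : P * d' + (b' + c') ≡ 4 * α * d' * b' * c') where

  shifted-product-identity :
    (+ (4 * α * d' * b') -ℤ + 1) *ℤ (+ (4 * α * d' * c') -ℤ + 1) ≡ + (4 * α * P * (d' * d')) +ℤ + 1
  shifted-product-identity = pred*pred≡suc (begin
    4 * α * d' * b' * (4 * α * d' * c')                    ≡⟨ factor-out-4αd' α d' b' c' ⟩
    4 * α * d' * (4 * α * d' * b' * c')                    ≡⟨ cong (4 * α * d' *_) ii ⟨
    4 * α * d' * (P * d' + (b' + c'))                      ≡⟨ expand α d' P b' c' ⟩
    4 * α * P * (d' * d') + 4 * α * d' * b' + 4 * α * d' * c' ∎)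
    where
    factor-out-4αd' : ∀ α d' b' c' →
      4 * α * d' * b' * (4 * α * d' * c') ≡ 4 * α * d' * (4 * α * d' * b' * c')
    factor-out-4αd' = ℕ-Ring.solve-∀

    expand : ∀ α d' P b' c' →
      4 * α * d' * (P * d' + (b' + c')) ≡ 4 * α * P * (d' * d') + 4 * α * d' * b' + 4 * α * d' * c'
    expand = ℕ-Ring.solve-∀

  d'∣b'+c' : d' ∣ b' + c'
  d'∣b'+c' = ∣m+n∣m⇒∣n (divides (4 * α * b' * c') (trans ii (move-d' α d' b' c'))) (n∣m*n P)
    where
    move-d' : ∀ α d' b' c' → 4 * α * d' * b' * c' ≡ 4 * α * b' * c' * d'
    move-d' = ℕ-Ring.solve-∀

lemma7p2 : (P b c δ α d' b' c' : ℕ) → Prime P → 0 < b → 0 < c →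
    4 * b * c ≡ P * δ + b + c →
    0 < α → SquareFree α →
    gcd b c ≡ α * d' →
    b ≡ gcd b c * b' → c ≡ gcd b c * c' →
    gcd b' c' ≡ 1 →
    (δ ≡ α * (d' * d') ⇔ P * d' + (b' + c') ≡ 4 * α * d' * b' * c')
    × (δ ≡ α * (d' * d') →
    ((+ (4 * α * d' * b') -ℤ + 1) *ℤ (+ (4 * α * d' * c') -ℤ + 1)
    ≡ + (4 * α * P * (d' * d')) +ℤ + 1)
    × d' ∣ (b' + c'))
lemma7p2 P b c δ α d' b' c' P-prime 0<b _ 4bc≡Pδ+b+c _ _ g≡αd' b≡gb' c≡gc' _ =
  i⇔ii , λ i → let ii = Equivalence.to i⇔ii i in
    shifted-product-identity P α d' b' c' ii , d'∣b'+c' P α d' b' c' ii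
  where
  b≡αd'b' : b ≡ α * d' * b'
  b≡αd'b' = trans b≡gb' (cong (_* b') g≡αd')

  c≡αd'c' : c ≡ α * d' * c'
  c≡αd'c' = trans c≡gc' (cong (_* c') g≡αd')

  instance
    P≢0 : NonZero P
    P≢0 = prime⇒nonZero P-prime

    αd'≢0 : NonZero (α * d')
    αd'≢0 = m*n≢0⇒m≢0 (α * d') {{>-nonZero (subst (0 <_) b≡αd'b' 0<b)}}

  hypothesis-divided : α * d' * (4 * α * d' * b' * c') ≡ P * δ + α * d' * (b' + c')
  hypothesis-divided =
    trans (cong (λ t → α * d' * (t * b' * c')) (*-assoc 4 α d'))
          (substitute-common-factor P δ (α * d') b' c' 4bc≡Pδ+b+c b≡αd'b' c≡αd'c')

  scale-ii : ∀ α d' P s → α * d' * (P * d' + s) ≡ P * (α * (d' * d')) + α * d' * s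
  scale-ii = ℕ-Ring.solve-∀

  i⇔ii : δ ≡ α * (d' * d') ⇔ P * d' + (b' + c') ≡ 4 * α * d' * b' * c'
  i⇔ii = affine-cancel-⇔ hypothesis-divided (scale-ii α d' P (b' + c'))
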